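{- Let $q\geq2$ be an integer and $k=2q$. Then for every $C\in\{A^pB,\ A^{p+1} : 1\leq p\leq k-1,\ p \text{ odd}\}\subseteq D_k$ there is a word $w=C_1C_2\cdots C_k$ with $C_i\in\{A,B\}$ such that $V(w)=C_1C_2\cdots C_k=C$ and the fiber matrix $M(w)$ satisfies $\det(M(w))=\pm1$.
   Context: $Sym(k)$ has composition $(CC')(i)=C(C'(i))$. $A=(1,2,\dots,k)$, i.e. $A(i)=i+1$ mod $k$; $B$ is the involution with $B(i)=q+1-i$ for $1\le i\le q$ and $B(i)=k+q+1-i$ for $q+1\le i\le k$; $D_k=\langle A,B\rangle\le Sym(k)$, a dihedral group of order $2k$. For a word $w=C_1\cdots C_k$ ($C_i\in\{A,B\}$), the fiber matrix $M(w)$ is the $k\times k$ zero-one integer matrix whose column $j$ has a $1$ in row $P_j(1)$ and, if $C_j=B$, also a $1$ in row $P_j(q+1)$, all other entries being $0$, where $P_j=C_1C_2\cdots C_{j-1}$ ($P_1$ the identity). Equivalently: in the semidirect product $\mathbb{Z}^k\rtimes D_k$ with product $\vec hC\cdot\vec h'C'=(\vec h+C\cdot\vec h')CC'$, $(C\cdot\vec h')_i=h'_{C^{ -1}(i)}$, and with $a(x)=(x,0,\dots,0)A$, $b(x)=(xe_1+xe_{q+1})B$, one has $\gamma_1(x_1)\cdots\gamma_k(x_k)=(M(w)\vec x^T)^T\,V(w)$, where $\gamma_i=a$ if $C_i=A$ and $\gamma_i=b$ if $C_i=B$. -}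

module Defs where

open import Data.Nat using (ℕ; zero; suc; _+_; _∸_; _≡ᵇ_; _<ᵇ_)
open import Data.Nat.Properties using ()
open import Data.Bool using (Bool; true; false; if_then_else_; _∨_; _∧_)
open import Data.Fin using (Fin; toℕ; punchIn) renaming (zero to fzero; suc to fsuc)
open import Data.Integer using (ℤ; 0ℤ; 1ℤ; -_) renaming (_+_ to _+ℤ_; _*_ to _*ℤ_)
open import Data.List using (List; []; _∷_; take)
open import Data.Vec using (Vec; toList; lookup)
open import Function using (_∘_; id)

-- Points of {1,…,k} are represented 0-indexed as naturals 0,…,k-1.
-- Permutations of {0,…,k-1} are represented as functions ℕ → ℕ;
-- composition is (C C')(i) = C (C' i), i.e. C ∘ C'.

A : (k : ℕ) → ℕ → ℕ
A k i = if suc i ≡ᵇ k then 0 else suc i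

-- B(i) = q+1-i for 1≤i≤q, B(i) = k+q+1-i for q+1≤i≤k   (1-indexed);
-- 0-indexed: B(j) = q-1-j for j<q, B(j) = k+q-1-j for q≤j<k.
B : (k q : ℕ) → ℕ → ℕ
B k q j = if j <ᵇ q then q ∸ suc j else (k + q) ∸ suc j

_^^_ : (ℕ → ℕ) → ℕ → (ℕ → ℕ)
C ^^ zero  = id
C ^^ suc n = C ∘ (C ^^ n)

data Gen : Set where
  gA gB : Gen

isB : Gen → Bool
isB gA = false
isB gB = true

act : (k q : ℕ) → Gen → ℕ → ℕ
act k q gA = A k
act k q gB = B k q

eval : (k q : ℕ) → List Gen → ℕ → ℕ
eval k q []       = id
eval k q (c ∷ cs) = act k q c ∘ eval k q cs

V : (k q : ℕ) → Vec Gen k → ℕ → ℕ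
V k q w = eval k q (toList w)

-- P_j = C₁ ⋯ C_{j-1}  (for the 0-indexed column j this is the product of the first j letters)
P : (k q : ℕ) → Vec Gen k → Fin k → ℕ → ℕ
P k q w j = eval k q (take (toℕ j) (toList w))

-- fiber matrix M(w): column j has a 1 in row P_j(1) and, if C_j = B, also in row P_j(q+1)
-- (0-indexed: rows P_j(0) and P_j(q)); all other entries 0.
M : (k q : ℕ) → Vec Gen k → Fin k → Fin k → ℤ
M k q w i j =
  if (toℕ i ≡ᵇ P k q w j 0) ∨ (isB (lookup w j) ∧ (toℕ i ≡ᵇ P k q w j q))
  then 1ℤ else 0ℤ

∑ : (n : ℕ) → (Fin n → ℤ) → ℤ
∑ zero    f = 0ℤ
∑ (suc n) f = f fzero +ℤ ∑ n (f ∘ fsuc)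

sgn : ℕ → ℤ
sgn zero    = 1ℤ
sgn (suc m) = - sgn m

det : (n : ℕ) → (Fin n → Fin n → ℤ) → ℤ
det zero    X = 1ℤ
det (suc n) X =
  ∑ (suc n) (λ j → sgn (toℕ j) *ℤ (X fzero j *ℤ det n (λ r c → X (fsuc r) (punchIn j c))))

-- On {0,…,k-1} a word in A and B acts as an affine map x ↦ s + e·x (mod k) with e = ±1, so V(w) and
-- the columns of M(w) are read off from the affine maps of the prefixes of w: a letter A after a prefix
-- with offset s gives the unit column at row s, a letter B the column with 1's in the antipodal rows s
-- and s + q. Each block BBAA advances the offset by 2 and contributes two unit columns and two antipodal
-- pairs. The words A^(b+2) (BBAA)^t A^b, A^(b+3) (BBAA)^t A^b B, B A^(b+1) (BBAA)^m A^b and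
-- B A^(b+2) (BBAA)^m A^b B realise A^(p+1) and A^p B for p large resp. small compared to q, and in each
-- of them every row is the lowest nonzero row of some column, with entry 1 there. So M(w) is
-- unitriangular up to a permutation of its columns, and Laplace expansion gives det M(w) = ±1.

module Submission where

open import Defs
open import Data.Nat as ℕ using (ℕ; zero; suc; _+_; _≤_; _<_; _∸_; _%_; _/_; z≤n; s≤s)
import Data.Nat.Properties as ℕ
import Data.Nat.DivMod as DivMod
open import Data.Integer using (ℤ; 0ℤ; 1ℤ; -_; -[1+_]) renaming (+_ to ι; _+_ to _⊕_; _*_ to _⊛_)
import Data.Integer.Properties as ℤ
open import Data.Fin as Fin using (Fin; toℕ; punchIn; punchOut)
import Data.Fin.Properties as Fin
open import Data.Bool using (true; false)
import Data.Bool.Properties as Bool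
open import Data.List using (List; []; _∷_; _++_; length; take)
import Data.List.Properties as List
open import Data.Vec using (Vec; toList; fromList; cast; lookup)
import Data.Vec.Properties as Vec
open import Data.Product using (Σ; ∃; _×_; _,_; proj₁; proj₂; map₂)
open import Data.Sum using (_⊎_; inj₁; inj₂; [_,_])
open import Data.Empty using (⊥; ⊥-elim)
open import Function using (_∘_)
open import Relation.Nullary using (yes; no)
open import Relation.Binary.Definitions using (tri<; tri≈; tri>)
open import Relation.Binary.PropositionalEquality
  using (_≡_; _≢_; refl; sym; trans; cong; cong₂; subst; subst₂; module ≡-Reasoning)
open import Data.Integer.Tactic.RingSolver using (solve-∀; solve)
import Data.Nat.Tactic.RingSolver as ℕ

-- Determinants

IsUnit : ℤ → Set
IsUnit d = d ≡ 1ℤ ⊎ d ≡ - 1ℤ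

-‿unit : ∀ {a} → IsUnit a → IsUnit (- a)
-‿unit (inj₁ refl) = inj₂ refl
-‿unit (inj₂ refl) = inj₁ refl

sgn-unit : ∀ m → IsUnit (sgn m)
sgn-unit zero    = inj₁ refl
sgn-unit (suc m) = -‿unit (sgn-unit m)

*-unit : ∀ {a b} → IsUnit a → IsUnit b → IsUnit (a ⊛ b)
*-unit (inj₁ refl) (inj₁ refl) = inj₁ refl
*-unit (inj₁ refl) (inj₂ refl) = inj₂ refl
*-unit (inj₂ refl) (inj₁ refl) = inj₂ refl
*-unit (inj₂ refl) (inj₂ refl) = inj₁ refl

∑-zero : ∀ n (f : Fin n → ℤ) → (∀ j → f j ≡ 0ℤ) → ∑ n f ≡ 0ℤ
∑-zero zero    f f≡0 = refl
∑-zero (suc n) f f≡0 = cong₂ _⊕_ (f≡0 Fin.zero) (∑-zero n (f ∘ Fin.suc) (f≡0 ∘ Fin.suc))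

∑-single : ∀ n (f : Fin n → ℤ) c → (∀ j → j ≢ c → f j ≡ 0ℤ) → ∑ n f ≡ f c
∑-single (suc n) f Fin.zero f≡0 = begin
  f Fin.zero ⊕ ∑ n (f ∘ Fin.suc) ≡⟨ cong (f Fin.zero ⊕_) (∑-zero n _ (λ j → f≡0 (Fin.suc j) λ ())) ⟩
  f Fin.zero ⊕ 0ℤ                ≡⟨ ℤ.+-identityʳ _ ⟩
  f Fin.zero                     ∎
  where open ≡-Reasoning
∑-single (suc n) f (Fin.suc c) f≡0 = begin
  f Fin.zero ⊕ ∑ n (f ∘ Fin.suc) ≡⟨ cong (_⊕ ∑ n (f ∘ Fin.suc)) (f≡0 Fin.zero λ ()) ⟩
  0ℤ ⊕ ∑ n (f ∘ Fin.suc)         ≡⟨ ℤ.+-identityˡ _ ⟩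
  ∑ n (f ∘ Fin.suc)              ≡⟨ ∑-single n (f ∘ Fin.suc) c f∘suc≡0 ⟩
  f (Fin.suc c)                  ∎
  where
  open ≡-Reasoning
  f∘suc≡0 : ∀ j → j ≢ c → f (Fin.suc j) ≡ 0ℤ
  f∘suc≡0 j j≢c = f≡0 (Fin.suc j) (j≢c ∘ Fin.suc-injective)

minor : ∀ {n} → (Fin (suc n) → Fin (suc n) → ℤ) → Fin (suc n) → Fin n → Fin n → ℤ
minor X j r c = X (Fin.suc r) (punchIn j c)

laplace-term : ∀ {n} → (Fin (suc n) → Fin (suc n) → ℤ) → Fin (suc n) → ℤ
laplace-term {n} X j = sgn (toℕ j) ⊛ (X Fin.zero j ⊛ det n (minor X j))

det-zero-column : ∀ n (X : Fin n → Fin n → ℤ) c → (∀ r → X r c ≡ 0ℤ) → det n X ≡ 0ℤ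

laplace-term-vanishes : ∀ {n} (X : Fin (suc n) → Fin (suc n) → ℤ) c j →
  (∀ r → X (Fin.suc r) c ≡ 0ℤ) → j ≢ c → laplace-term X j ≡ 0ℤ
laplace-term-vanishes {n} X c j X·c≡0 j≢c = begin
  sgn (toℕ j) ⊛ (X Fin.zero j ⊛ det n (minor X j))
    ≡⟨ cong (λ d → sgn (toℕ j) ⊛ (X Fin.zero j ⊛ d))
         (det-zero-column n (minor X j) (punchOut j≢c)
           (λ r → trans (cong (X (Fin.suc r)) (Fin.punchIn-punchOut j≢c)) (X·c≡0 r))) ⟩
  sgn (toℕ j) ⊛ (X Fin.zero j ⊛ 0ℤ)
    ≡⟨ cong (sgn (toℕ j) ⊛_) (ℤ.*-zeroʳ (X Fin.zero j)) ⟩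
  sgn (toℕ j) ⊛ 0ℤ
    ≡⟨ ℤ.*-zeroʳ (sgn (toℕ j)) ⟩
  0ℤ ∎
  where open ≡-Reasoning

det-zero-column (suc n) X c X·c≡0 = ∑-zero (suc n) (laplace-term X) term≡0
  where
  term≡0 : ∀ j → laplace-term X j ≡ 0ℤ
  term≡0 j with j Fin.≟ c
  ... | yes refl = trans (cong (λ x → sgn (toℕ j) ⊛ (x ⊛ det n (minor X j))) (X·c≡0 Fin.zero))
                          (ℤ.*-zeroʳ (sgn (toℕ j)))
  ... | no j≢c = laplace-term-vanishes X c j (X·c≡0 ∘ Fin.suc) j≢c

record Pivots {n} (X : Fin n → Fin n → ℤ) : Set where
  field
    σ       : Fin n → Fin n
    on      : ∀ i → X i (σ i) ≡ 1ℤ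
    below   : ∀ i r → toℕ i < toℕ r → X r (σ i) ≡ 0ℤ

  distinct : ∀ i i′ → σ i ≡ σ i′ → toℕ i < toℕ i′ → ⊥
  distinct i i′ e i<i′ with trans (sym (on i′)) (trans (cong (X i′) (sym e)) (below i i′ i<i′))
  ... | ()

  σ-injective : ∀ i i′ → σ i ≡ σ i′ → i ≡ i′
  σ-injective i i′ e with ℕ.<-cmp (toℕ i) (toℕ i′)
  ... | tri≈ _ i≡i′ _ = Fin.toℕ-injective i≡i′
  ... | tri< i<i′ _ _ = ⊥-elim (distinct i i′ e i<i′)
  ... | tri> _ _ i′<i = ⊥-elim (distinct i′ i (sym e) i′<i)

pivots⇒det-unit : ∀ n (X : Fin n → Fin n → ℤ) → Pivots X → IsUnit (det n X)
pivots⇒det-unit zero    X _  = inj₁ refl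
pivots⇒det-unit (suc n) X pv =
  subst IsUnit (sym expand) (*-unit (sgn-unit (toℕ c)) (pivots⇒det-unit n (minor X c) pv′))
  where
  open Pivots pv
  c = σ Fin.zero
  c≢σsuc : ∀ r → c ≢ σ (Fin.suc r)
  c≢σsuc r e with σ-injective Fin.zero (Fin.suc r) e
  ... | ()
  pv′ : Pivots (minor X c)
  pv′ = record
    { σ     = λ r → punchOut (c≢σsuc r)
    ; on    = λ i → trans (cong (X (Fin.suc i)) (Fin.punchIn-punchOut (c≢σsuc i))) (on (Fin.suc i))
    ; below = λ i r i<r →
        trans (cong (X (Fin.suc r)) (Fin.punchIn-punchOut (c≢σsuc i))) (below (Fin.suc i) (Fin.suc r) (s≤s i<r))
    }
  expand : det (suc n) X ≡ sgn (toℕ c) ⊛ det n (minor X c)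
  expand = begin
    ∑ (suc n) (laplace-term X)
      ≡⟨ ∑-single (suc n) (laplace-term X) c
           (λ j → laplace-term-vanishes X c j (λ r → below Fin.zero (Fin.suc r) (s≤s z≤n))) ⟩
    sgn (toℕ c) ⊛ (X Fin.zero c ⊛ det n (minor X c))
      ≡⟨ cong (λ x → sgn (toℕ c) ⊛ (x ⊛ det n (minor X c))) (on Fin.zero) ⟩
    sgn (toℕ c) ⊛ (1ℤ ⊛ det n (minor X c))
      ≡⟨ cong (sgn (toℕ c) ⊛_) (ℤ.*-identityˡ _) ⟩
    sgn (toℕ c) ⊛ det n (minor X c) ∎
    where open ≡-Reasoning

-- Arithmetic

split : ∀ r n → r < n ⊎ ∃ λ u → r ≡ n + u
split r       zero    = inj₂ (r , refl)
split zero    (suc n) = inj₁ (s≤s z≤n)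
split (suc r) (suc n) with split r n
... | inj₁ r<n       = inj₁ (s≤s r<n)
... | inj₂ (u , r≡)  = inj₂ (u , cong suc r≡)

parity : ∀ v → ∃ λ i → v ≡ i + i ⊎ v ≡ suc (i + i)
parity zero = 0 , inj₁ refl
parity (suc v) with parity v
... | i , inj₁ v≡ = i , inj₂ (cong suc v≡)
... | i , inj₂ v≡ = suc i , inj₁ (cong suc (trans v≡ (sym (ℕ.+-suc i i))))

gap : ∀ {m n} → m < n → ∃ λ d → m + suc d ≡ n
gap {zero}  {suc n} _         = n , refl
gap {suc m} {suc n} (s≤s m<n) = map₂ (cong suc) (gap m<n)

≤-gap : ∀ {m n} → m ≤ n → ∃ λ d → m + d ≡ n
≤-gap {zero}  {n}     _         = n , refl
≤-gap {suc m} {suc n} (s≤s m≤n) = map₂ (cong suc) (≤-gap m≤n)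

half-< : ∀ {i t} → i + i < t + t → i < t
half-< 2i<2t = ℕ.≰⇒> (λ t≤i → ℕ.<⇒≱ 2i<2t (ℕ.+-mono-≤ t≤i t≤i))

≤-via : ∀ {m n} d → m + d ≡ n → m ≤ n
≤-via {m} d refl = ℕ.m≤m+n m d

≡ᵇ-true : ∀ {m n} → m ≡ n → (m ℕ.≡ᵇ n) ≡ true
≡ᵇ-true {zero}  refl = refl
≡ᵇ-true {suc m} refl = ≡ᵇ-true {m} refl

≡ᵇ-false : ∀ m n → m ≢ n → (m ℕ.≡ᵇ n) ≡ false
≡ᵇ-false zero    zero    m≢n = ⊥-elim (m≢n refl)
≡ᵇ-false zero    (suc n) _   = refl
≡ᵇ-false (suc m) zero    _   = refl
≡ᵇ-false (suc m) (suc n) m≢n = ≡ᵇ-false m n (m≢n ∘ cong suc)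

<ᵇ-true : ∀ {m n} → m < n → (m ℕ.<ᵇ n) ≡ true
<ᵇ-true {zero}  {suc n} _         = refl
<ᵇ-true {suc m} {suc n} (s≤s m<n) = <ᵇ-true m<n

<ᵇ-false : ∀ {m n} → n ≤ m → (m ℕ.<ᵇ n) ≡ false
<ᵇ-false {zero}  {zero}  _         = refl
<ᵇ-false {suc m} {zero}  _         = refl
<ᵇ-false {suc m} {suc n} (s≤s n≤m) = <ᵇ-false n≤m

%2≡1⇒odd : ∀ p → p % 2 ≡ 1 → ∃ λ m → p ≡ suc (m + m)
%2≡1⇒odd p p%2≡1 =
  p / 2 , trans (DivMod.m≡m%n+[m/n]*n p 2) (trans (cong (_+ (p / 2) ℕ.* 2) p%2≡1) (lemma (p / 2)))
  where lemma : ∀ m → 1 + m ℕ.* 2 ≡ suc (m + m)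
        lemma = ℕ.solve-∀

odd-bound : ∀ q m → suc (m + m) ≤ (q + q) ∸ 1 → m < q
odd-bound (suc q) m 2m+1≤2q+1 = s≤s (ℕ.≮⇒≥ λ q<m → ℕ.<⇒≱ (ℕ.+-mono-< q<m q<m) 2m≤2q)
  where 2m≤2q = ℕ.s≤s⁻¹ (subst (suc (m + m) ≤_) (ℕ.+-suc q q) 2m+1≤2q+1)

isolate : ∀ {d y s} → d ⊕ y ≡ s → d ≡ s ⊕ - y
isolate {d} {y} refl = lemma d y
  where lemma : ∀ d y → d ≡ (d ⊕ y) ⊕ - y
        lemma = solve-∀

infix 4 _≡_mod_
record _≡_mod_ (a b : ℤ) (n : ℕ) : Set where
  constructor by
  field
    quotient : ℤ
    equation : a ≡ b ⊕ quotient ⊛ ι n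

module _ {n : ℕ} where

  ≡⇒≡-mod : ∀ {a b} → a ≡ b → a ≡ b mod n
  ≡⇒≡-mod {a} refl = by 0ℤ (lemma a (ι n))
    where lemma : ∀ a n → a ≡ a ⊕ 0ℤ ⊛ n
          lemma = solve-∀

  mod-refl : ∀ {a} → a ≡ a mod n
  mod-refl = ≡⇒≡-mod refl

  mod-sym : ∀ {a b} → a ≡ b mod n → b ≡ a mod n
  mod-sym {a} {b} (by z a≡) = by (- z) (trans (lemma b z (ι n)) (cong (λ x → x ⊕ (- z) ⊛ ι n) (sym a≡)))
    where lemma : ∀ b z n → b ≡ (b ⊕ z ⊛ n) ⊕ (- z) ⊛ n
          lemma = solve-∀

  mod-trans : ∀ {a b c} → a ≡ b mod n → b ≡ c mod n → a ≡ c mod n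
  mod-trans {c = c} (by z refl) (by z′ refl) = by (z′ ⊕ z) (lemma c z z′ (ι n))
    where lemma : ∀ c z z′ n → (c ⊕ z′ ⊛ n) ⊕ z ⊛ n ≡ c ⊕ (z′ ⊕ z) ⊛ n
          lemma = solve-∀

  mod-+ : ∀ {a b c d} → a ≡ b mod n → c ≡ d mod n → a ⊕ c ≡ b ⊕ d mod n
  mod-+ {b = b} {d = d} (by z refl) (by z′ refl) = by (z ⊕ z′) (lemma b d z z′ (ι n))
    where lemma : ∀ b d z z′ n → (b ⊕ z ⊛ n) ⊕ (d ⊕ z′ ⊛ n) ≡ (b ⊕ d) ⊕ (z ⊕ z′) ⊛ n
          lemma = solve-∀

  mod-+ˡ : ∀ c {a b} → a ≡ b mod n → c ⊕ a ≡ c ⊕ b mod n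
  mod-+ˡ c = mod-+ (mod-refl {c})

  mod-+ʳ : ∀ c {a b} → a ≡ b mod n → a ⊕ c ≡ b ⊕ c mod n
  mod-+ʳ c a≡b = mod-+ a≡b (mod-refl {c})

  mod-neg : ∀ {a b} → a ≡ b mod n → - a ≡ - b mod n
  mod-neg {b = b} (by z refl) = by (- z) (lemma b z (ι n))
    where lemma : ∀ b z n → - (b ⊕ z ⊛ n) ≡ - b ⊕ (- z) ⊛ n
          lemma = solve-∀

  no-positive-quotient : ∀ {a b} m → a < n → ι a ≢ ι b ⊕ ι (suc m) ⊛ ι n
  no-positive-quotient {a} {b} m a<n e =
    ℕ.<⇒≱ a<n (subst (n ≤_) (sym a≡) (ℕ.≤-trans (ℕ.m≤m+n n _) (ℕ.m≤n+m _ b)))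
    where a≡ : a ≡ b + suc m ℕ.* n
          a≡ = ℤ.+-injective (trans e (cong (ι b ⊕_) (sym (ℤ.pos-* (suc m) n))))

  mod-unique : ∀ {a b} → a < n → b < n → ι a ≡ ι b mod n → a ≡ b
  mod-unique {a} {b} _   _   (by (ι zero) e)    = ℤ.+-injective (trans e (ℤ.+-identityʳ (ι b)))
  mod-unique         a<n _   (by (ι (suc m)) e) = ⊥-elim (no-positive-quotient m a<n e)
  mod-unique         _   b<n a≡b@(by -[1+ m ] _) =
    ⊥-elim (no-positive-quotient m b<n (_≡_mod_.equation (mod-sym a≡b)))

-- Words

As : ℕ → List Gen
As zero    = []
As (suc n) = gA ∷ As n

blocks : ℕ → List Gen
blocks zero    = []
blocks (suc t) = gB ∷ gB ∷ gA ∷ gA ∷ blocks t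

shape : List Gen → ℕ → ℕ → ℕ → List Gen → List Gen
shape pre a t b post = pre ++ As a ++ blocks t ++ As b ++ post

length-shape : ∀ pre a t b post →
  length (shape pre a t b post) ≡ length pre + (a + ((t + t + t + t) + (b + length post)))
length-shape pre a t b post =
  trans (List.length-++ pre) (cong (length pre +_)
    (trans (List.length-++ (As a)) (cong₂ _+_ (length-As a)
      (trans (List.length-++ (blocks t)) (cong₂ _+_ (length-blocks t)
        (trans (List.length-++ (As b)) (cong (_+ length post) (length-As b))))))))
  where
  length-As : ∀ n → length (As n) ≡ n
  length-As zero    = refl
  length-As (suc n) = cong suc (length-As n)
  length-blocks : ∀ t → length (blocks t) ≡ t + t + t + t
  length-blocks zero    = refl
  length-blocks (suc t) = trans (cong (λ n → 4 + n) (length-blocks t)) (lemma t)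
    where lemma : ∀ t → 4 + (t + t + t + t) ≡ suc t + suc t + suc t + suc t
          lemma = ℕ.solve-∀

Occurs : List Gen → Gen → List Gen → Set
Occurs xs y L = ∃ λ ys → L ≡ xs ++ y ∷ ys

occurs-++ˡ : ∀ pre {xs y L} → Occurs xs y L → Occurs (pre ++ xs) y (pre ++ L)
occurs-++ˡ pre {xs} {y} (ys , refl) = ys , sym (List.++-assoc pre xs (y ∷ ys))

occurs-++ʳ : ∀ R {xs y L} → Occurs xs y L → Occurs xs y (L ++ R)
occurs-++ʳ R {xs} {y} (ys , refl) = ys ++ R , List.++-assoc xs (y ∷ ys) R

occurs-As : ∀ {u n} → u < n → Occurs (As u) gA (As n)
occurs-As {zero}  {suc n} _         = As n , refl
occurs-As {suc u} {suc n} (s≤s u<n) = map₂ (cong (gA ∷_)) (occurs-As u<n)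

occurs-blocks : ∀ {i t} part {y rest} → i < t → gB ∷ gB ∷ gA ∷ gA ∷ [] ≡ part ++ y ∷ rest →
  Occurs (blocks i ++ part) y (blocks t)
occurs-blocks {zero}  {suc t} part {y} {rest} _ e =
  rest ++ blocks t , trans (cong (_++ blocks t) e) (List.++-assoc part (y ∷ rest) (blocks t))
occurs-blocks {suc i} {suc t} part (s≤s i<t) e = occurs-++ˡ (gB ∷ gB ∷ gA ∷ gA ∷ []) (occurs-blocks part i<t e)

column : ∀ {n} (w : Vec Gen n) {xs y} → Occurs xs y (toList w) →
  Σ (Fin n) λ c → lookup w c ≡ y × take (toℕ c) (toList w) ≡ xs
column (x Data.Vec.∷ w) {[]}      (ys , refl) = Fin.zero , refl , refl
column (x Data.Vec.∷ w) {x′ ∷ xs} (ys , e) with List.∷-injective e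
... | refl , e′ with column w (ys , e′)
...   | c , lookup≡ , take≡ = Fin.suc c , lookup≡ , cong (x ∷_) take≡

Solution : ℕ → (ℕ → ℕ) → Set
Solution q C = ∃ λ (w : Vec Gen (q + q)) →
  (∀ i → i < q + q → V (q + q) q w i ≡ C i) × IsUnit (det (q + q) (M (q + q) q w))

solution-cong : ∀ {q C C′} → (∀ i → i < q + q → C i ≡ C′ i) → Solution q C′ → Solution q C
solution-cong C≡C′ (w , value , unit) = w , (λ i i<k → trans (value i i<k) (sym (C≡C′ i i<k))) , unit

Rotation : ℕ → ℕ → Set
Rotation q m = Solution q (A (q + q) ^^ suc (suc (m + m)))

Reflection : ℕ → ℕ → Set
Reflection q m = Solution q ((A (q + q) ^^ suc (m + m)) ∘ B (q + q) q)

module Words (q : ℕ) where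

  k : ℕ
  k = q + q

  ev : List Gen → ℕ → ℕ
  ev = eval k q

  shift : List Gen → ℤ
  shift []        = 0ℤ
  shift (gA ∷ xs) = 1ℤ ⊕ shift xs
  shift (gB ∷ xs) = (ι q ⊕ - 1ℤ) ⊕ - shift xs

  sign : List Gen → ℤ
  sign []        = 1ℤ
  sign (gA ∷ xs) = sign xs
  sign (gB ∷ xs) = - sign xs

  A-affine : ∀ {x} → x < k → A k x < k × ι (A k x) ≡ 1ℤ ⊕ ι x mod k
  A-affine {x} x<k with suc x ℕ.≟ k
  ... | yes 1+x≡k rewrite ≡ᵇ-true 1+x≡k =
    ℕ.≤-trans (s≤s z≤n) x<k ,
    by (- 1ℤ) (trans (lemma (ι x)) (cong (λ n → (1ℤ ⊕ ι x) ⊕ - 1ℤ ⊛ ι n) 1+x≡k))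
    where lemma : ∀ x → 0ℤ ≡ (1ℤ ⊕ x) ⊕ - 1ℤ ⊛ (1ℤ ⊕ x)
          lemma = solve-∀
  ... | no 1+x≢k rewrite ≡ᵇ-false (suc x) k 1+x≢k = ℕ.≤∧≢⇒< x<k 1+x≢k , mod-refl

  B-affine : ∀ {x} → x < k → B k q x < k × ι (B k q x) ≡ (ι q ⊕ - 1ℤ) ⊕ - ι x mod k
  B-affine {x} x<k with x ℕ.<? q
  ... | yes x<q rewrite <ᵇ-true x<q = d<k , ≡⇒≡-mod (lemma (ι d) (ι x) (ι q) (cong ι d+1+x≡q))
    where
    d = q ∸ suc x
    d+1+x≡q : d + suc x ≡ q
    d+1+x≡q = ℕ.m∸n+n≡m x<q
    d<k : d < k
    d<k = ℕ.≤-trans (≤-via x (trans (sym (ℕ.+-suc d x)) d+1+x≡q)) (ℕ.m≤m+n q q)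
    lemma : ∀ d x q → d ⊕ (1ℤ ⊕ x) ≡ q → d ≡ (q ⊕ - 1ℤ) ⊕ - x
    lemma d x q e = trans (isolate e) (rearrange x q)
      where rearrange : ∀ x q → q ⊕ - (1ℤ ⊕ x) ≡ (q ⊕ - 1ℤ) ⊕ - x
            rearrange = solve-∀
  ... | no x≮q rewrite <ᵇ-false (ℕ.≮⇒≥ x≮q) = d<k , by 1ℤ (lemma (ι d) (ι x) (ι q) (cong ι d+1+x≡k+q))
    where
    d = (k + q) ∸ suc x
    d+1+x≡k+q : d + suc x ≡ k + q
    d+1+x≡k+q = ℕ.m∸n+n≡m (ℕ.≤-trans x<k (ℕ.m≤m+n k q))
    d<k : d < k
    d<k = ℕ.+-cancelʳ-< (suc x) d k
            (subst (_< k + suc x) (sym d+1+x≡k+q) (ℕ.+-monoʳ-< k (s≤s (ℕ.≮⇒≥ x≮q))))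
    lemma : ∀ d x q → d ⊕ (1ℤ ⊕ x) ≡ (q ⊕ q) ⊕ q → d ≡ ((q ⊕ - 1ℤ) ⊕ - x) ⊕ 1ℤ ⊛ (q ⊕ q)
    lemma d x q e = trans (isolate e) (rearrange x q)
      where rearrange : ∀ x q → (q ⊕ q) ⊕ q ⊕ - (1ℤ ⊕ x) ≡ ((q ⊕ - 1ℤ) ⊕ - x) ⊕ 1ℤ ⊛ (q ⊕ q)
            rearrange = solve-∀

  eval-affine : ∀ xs {x} → x < k → ev xs x < k × ι (ev xs x) ≡ shift xs ⊕ sign xs ⊛ ι x mod k
  eval-affine []        {x} x<k = x<k , ≡⇒≡-mod (lemma (ι x))
    where lemma : ∀ x → x ≡ 0ℤ ⊕ 1ℤ ⊛ x
          lemma = solve-∀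
  eval-affine (gA ∷ xs) {x} x<k =
    proj₁ (A-affine y<k) ,
    mod-trans (proj₂ (A-affine y<k)) (mod-trans (mod-+ˡ 1ℤ y≡) (≡⇒≡-mod (lemma (shift xs) (sign xs) (ι x))))
    where
    open Σ (eval-affine xs x<k) renaming (proj₁ to y<k; proj₂ to y≡)
    lemma : ∀ s e x → 1ℤ ⊕ (s ⊕ e ⊛ x) ≡ (1ℤ ⊕ s) ⊕ e ⊛ x
    lemma = solve-∀
  eval-affine (gB ∷ xs) {x} x<k =
    proj₁ (B-affine y<k) ,
    mod-trans (proj₂ (B-affine y<k))
      (mod-trans (mod-+ˡ (ι q ⊕ - 1ℤ) (mod-neg y≡)) (≡⇒≡-mod (lemma (ι q) (shift xs) (sign xs) (ι x))))
    where
    open Σ (eval-affine xs x<k) renaming (proj₁ to y<k; proj₂ to y≡)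
    lemma : ∀ q s e x → (q ⊕ - 1ℤ) ⊕ - (s ⊕ e ⊛ x) ≡ ((q ⊕ - 1ℤ) ⊕ - s) ⊕ (- e) ⊛ x
    lemma = solve-∀

  eval-cong : ∀ xs ys → shift xs ≡ shift ys mod k → sign xs ≡ sign ys → ∀ x → x < k → ev xs x ≡ ev ys x
  eval-cong xs ys shift≡ sign≡ x x<k =
    mod-unique (proj₁ (eval-affine xs x<k)) (proj₁ (eval-affine ys x<k))
      (mod-trans (proj₂ (eval-affine xs x<k))
        (mod-trans (mod-+ shift≡ (≡⇒≡-mod (cong (_⊛ ι x) sign≡))) (mod-sym (proj₂ (eval-affine ys x<k)))))

  ev-As-++ : ∀ n ys x → ev (As n ++ ys) x ≡ (A k ^^ n) (ev ys x)
  ev-As-++ zero    ys x = refl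
  ev-As-++ (suc n) ys x = cong (A k) (ev-As-++ n ys x)

  sign-unit : ∀ xs → IsUnit (sign xs)
  sign-unit []        = inj₁ refl
  sign-unit (gA ∷ xs) = sign-unit xs
  sign-unit (gB ∷ xs) = -‿unit (sign-unit xs)

  sign-q : ∀ xs → sign xs ⊛ ι q ≡ ι q mod k
  sign-q xs with sign-unit xs
  ... | inj₁ e = ≡⇒≡-mod (trans (cong (_⊛ ι q) e) (ℤ.*-identityˡ (ι q)))
  ... | inj₂ e = subst (λ e → e ⊛ ι q ≡ ι q mod k) (sym e) (by (- 1ℤ) (lemma (ι q)))
    where lemma : ∀ q → - 1ℤ ⊛ q ≡ q ⊕ - 1ℤ ⊛ (q ⊕ q)
          lemma = solve-∀

  +q+q : ∀ s → s ⊕ ι q ⊕ ι q ≡ s mod k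
  +q+q s = by 1ℤ (lemma s (ι q))
    where lemma : ∀ s q → s ⊕ q ⊕ q ≡ s ⊕ 1ℤ ⊛ (q ⊕ q)
          lemma = solve-∀

  shift-++ : ∀ xs ys → shift (xs ++ ys) ≡ shift xs ⊕ sign xs ⊛ shift ys
  shift-++ []        ys = lemma (shift ys)
    where lemma : ∀ t → t ≡ 0ℤ ⊕ 1ℤ ⊛ t
          lemma = solve-∀
  shift-++ (gA ∷ xs) ys = trans (cong (1ℤ ⊕_) (shift-++ xs ys)) (lemma (shift xs) (sign xs) (shift ys))
    where lemma : ∀ s e t → 1ℤ ⊕ (s ⊕ e ⊛ t) ≡ (1ℤ ⊕ s) ⊕ e ⊛ t
          lemma = solve-∀
  shift-++ (gB ∷ xs) ys =
    trans (cong (λ s → (ι q ⊕ - 1ℤ) ⊕ - s) (shift-++ xs ys)) (lemma (ι q) (shift xs) (sign xs) (shift ys))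
    where lemma : ∀ q s e t → (q ⊕ - 1ℤ) ⊕ - (s ⊕ e ⊛ t) ≡ ((q ⊕ - 1ℤ) ⊕ - s) ⊕ (- e) ⊛ t
          lemma = solve-∀

  sign-++ : ∀ xs ys → sign (xs ++ ys) ≡ sign xs ⊛ sign ys
  sign-++ []        ys = sym (ℤ.*-identityˡ (sign ys))
  sign-++ (gA ∷ xs) ys = sign-++ xs ys
  sign-++ (gB ∷ xs) ys = trans (cong -_ (sign-++ xs ys)) (ℤ.neg-distribˡ-* (sign xs) (sign ys))

  shift-As-++ : ∀ a ys → shift (As a ++ ys) ≡ ι a ⊕ shift ys
  shift-As-++ zero    ys = sym (ℤ.+-identityˡ (shift ys))
  shift-As-++ (suc a) ys = trans (cong (1ℤ ⊕_) (shift-As-++ a ys)) (sym (ℤ.+-assoc 1ℤ (ι a) (shift ys)))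

  sign-As-++ : ∀ a ys → sign (As a ++ ys) ≡ sign ys
  sign-As-++ zero    ys = refl
  sign-As-++ (suc a) ys = sign-As-++ a ys

  shift-blocks-++ : ∀ t ys → shift (blocks t ++ ys) ≡ ι (t + t) ⊕ shift ys
  shift-blocks-++ zero    ys = sym (ℤ.+-identityˡ (shift ys))
  shift-blocks-++ (suc t) ys =
    trans (cong (λ s → (ι q ⊕ - 1ℤ) ⊕ - ((ι q ⊕ - 1ℤ) ⊕ - (1ℤ ⊕ (1ℤ ⊕ s)))) (shift-blocks-++ t ys))
      (trans (lemma (ι q) (ι t) (shift ys)) (cong (λ n → ι (suc n) ⊕ shift ys) (sym (ℕ.+-suc t t))))
    where lemma : ∀ q t s →
            (q ⊕ - 1ℤ) ⊕ - ((q ⊕ - 1ℤ) ⊕ - (1ℤ ⊕ (1ℤ ⊕ ((t ⊕ t) ⊕ s)))) ≡ (1ℤ ⊕ (1ℤ ⊕ (t ⊕ t))) ⊕ s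
          lemma = solve-∀

  sign-blocks-++ : ∀ t ys → sign (blocks t ++ ys) ≡ sign ys
  sign-blocks-++ zero    ys = refl
  sign-blocks-++ (suc t) ys = trans (ℤ.neg-involutive _) (sign-blocks-++ t ys)

  shift-As : ∀ n → shift (As n) ≡ ι n
  shift-As zero    = refl
  shift-As (suc n) = cong (1ℤ ⊕_) (shift-As n)

  shift-As-blocks-++ : ∀ a i ys → shift (As a ++ blocks i ++ ys) ≡ ι (a + (i + i)) ⊕ shift ys
  shift-As-blocks-++ a i ys =
    trans (shift-As-++ a (blocks i ++ ys))
      (trans (cong (ι a ⊕_) (shift-blocks-++ i ys)) (sym (ℤ.+-assoc (ι a) (ι (i + i)) (shift ys))))

  shift-pre-++ : ∀ pre {xs n} → shift xs ≡ ι n → shift (pre ++ xs) ≡ shift pre ⊕ sign pre ⊛ ι n mod k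
  shift-pre-++ pre {xs} xs≡n =
    ≡⇒≡-mod (trans (shift-++ pre xs) (cong (λ s → shift pre ⊕ sign pre ⊛ s) xs≡n))

  Pivot : Vec Gen k → Fin k → Set
  Pivot w j = Σ (Fin k) λ c → M k q w j c ≡ 1ℤ × (∀ i → toℕ j < toℕ i → M k q w i c ≡ 0ℤ)

  A-column-pivot : ∀ w c j → lookup w c ≡ gA → P k q w c 0 ≡ toℕ j → Pivot w j
  A-column-pivot w c j c≡A row≡j = c , on , below
    where
    on : M k q w j c ≡ 1ℤ
    on rewrite c≡A | row≡j | ≡ᵇ-true {toℕ j} refl = refl
    below : ∀ i → toℕ j < toℕ i → M k q w i c ≡ 0ℤ
    below i j<i rewrite c≡A | row≡j | ≡ᵇ-false (toℕ i) (toℕ j) (ℕ.>⇒≢ j<i) = refl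

  B-column-pivot : ∀ w c j {r₀ r₁} → lookup w c ≡ gB → P k q w c 0 ≡ r₀ → P k q w c q ≡ r₁ →
    r₀ ≤ toℕ j → r₁ ≤ toℕ j → r₀ ≡ toℕ j ⊎ r₁ ≡ toℕ j → Pivot w j
  B-column-pivot w c j {r₀} {r₁} c≡B row₀ row₁ r₀≤j r₁≤j r≡j = c , on r≡j , below
    where
    on : r₀ ≡ toℕ j ⊎ r₁ ≡ toℕ j → M k q w j c ≡ 1ℤ
    on (inj₁ refl) rewrite c≡B | row₀ | row₁ | ≡ᵇ-true {r₀} refl = refl
    on (inj₂ refl)
      rewrite c≡B | row₀ | row₁ | ≡ᵇ-true {r₁} refl | Bool.∨-zeroʳ (r₁ ℕ.≡ᵇ r₀) = refl
    below : ∀ i → toℕ j < toℕ i → M k q w i c ≡ 0ℤ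
    below i j<i rewrite c≡B | row₀ | row₁
      | ≡ᵇ-false (toℕ i) r₀ (ℕ.>⇒≢ (ℕ.≤-<-trans r₀≤j j<i))
      | ≡ᵇ-false (toℕ i) r₁ (ℕ.>⇒≢ (ℕ.≤-<-trans r₁≤j j<i)) = refl

  same-residue : ∀ {a b s} → a < k → b < k → ι a ≡ s mod k → ι b ≡ s mod k → a ≡ b
  same-residue a<k b<k a≡s b≡s = mod-unique a<k b<k (mod-trans a≡s (mod-sym b≡s))

  eval-at-0 : ∀ xs → 0 < k → ev xs 0 < k × ι (ev xs 0) ≡ shift xs mod k
  eval-at-0 xs 0<k =
    proj₁ (eval-affine xs 0<k) , mod-trans (proj₂ (eval-affine xs 0<k)) (≡⇒≡-mod (lemma (shift xs) (sign xs)))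
    where lemma : ∀ s e → s ⊕ e ⊛ 0ℤ ≡ s
          lemma = solve-∀

  eval-at-q : ∀ xs → q < k → ev xs q < k × ι (ev xs q) ≡ shift xs ⊕ ι q mod k
  eval-at-q xs q<k = proj₁ (eval-affine xs q<k) , mod-trans (proj₂ (eval-affine xs q<k)) (mod-+ˡ (shift xs) (sign-q xs))

  column-rows : ∀ w {xs y} (occ : Occurs xs y (toList w)) x → P k q w (proj₁ (column w occ)) x ≡ ev xs x
  column-rows w occ x = cong (λ ys → ev ys x) (proj₂ (proj₂ (column w occ)))

  unit-pivot : ∀ w {xs} j → Occurs xs gA (toList w) → ι (toℕ j) ≡ shift xs mod k → Pivot w j
  unit-pivot w {xs} j occ j≡s =
    A-column-pivot w c j c≡A (trans (column-rows w occ 0) (same-residue (proj₁ r₀) j<k (proj₂ r₀) j≡s))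
    where
    open Σ (column w occ) renaming (proj₁ to c)
    c≡A = proj₁ (proj₂ (column w occ))
    j<k = Fin.toℕ<n j
    r₀ = eval-at-0 xs (ℕ.≤-trans (s≤s z≤n) j<k)

  -- The 1's of a B-column lie in the rows ≡ shift and ≡ shift + q; since q + q ≡ 0 either residue s
  -- names this pair of rows, and a row j ≥ q of the pair is the lower one.
  pair-pivot : ∀ w {xs} j s → Occurs xs gB (toList w) → shift xs ≡ s mod k ⊎ shift xs ≡ s ⊕ ι q mod k →
    ι (toℕ j) ≡ s mod k → q ≤ toℕ j → Pivot w j
  pair-pivot w {xs} j s occ shift≡ j≡s q≤j = pivot shift≡
    where
    open Σ (column w occ) renaming (proj₁ to c)
    c≡B = proj₁ (proj₂ (column w occ))
    j<k = Fin.toℕ<n j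
    r₀ = eval-at-0 xs (ℕ.≤-trans (s≤s z≤n) j<k)
    r₁ = eval-at-q xs (ℕ.≤-<-trans q≤j j<k)
    row₀≡ : ∀ {r} → r < k → ι r ≡ shift xs mod k → P k q w c 0 ≡ r
    row₀≡ r<k r≡ = trans (column-rows w occ 0) (same-residue (proj₁ r₀) r<k (proj₂ r₀) r≡)
    row₁≡ : ∀ {r} → r < k → ι r ≡ shift xs ⊕ ι q mod k → P k q w c q ≡ r
    row₁≡ r<k r≡ = trans (column-rows w occ q) (same-residue (proj₁ r₁) r<k (proj₂ r₁) r≡)
    d = toℕ j ∸ q
    d+q≡j : d + q ≡ toℕ j
    d+q≡j = ℕ.m∸n+n≡m q≤j
    d≤j : d ≤ toℕ j
    d≤j = ≤-via q d+q≡j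
    d<k = ℕ.≤-<-trans d≤j j<k
    d≡s+q : ι d ≡ s ⊕ ι q mod k
    d≡s+q = mod-trans (mod-sym (+q+q (ι d)))
              (mod-trans (≡⇒≡-mod (cong (λ n → ι n ⊕ ι q) d+q≡j)) (mod-+ʳ (ι q) j≡s))
    pivot : shift xs ≡ s mod k ⊎ shift xs ≡ s ⊕ ι q mod k → Pivot w j
    pivot (inj₁ shift≡s) =
      B-column-pivot w c j c≡B
        (row₀≡ j<k (mod-trans j≡s (mod-sym shift≡s)))
        (row₁≡ d<k (mod-trans d≡s+q (mod-sym (mod-+ʳ (ι q) shift≡s))))
        ℕ.≤-refl d≤j (inj₁ refl)
    pivot (inj₂ shift≡s+q) =
      B-column-pivot w c j c≡B
        (row₀≡ d<k (mod-trans d≡s+q (mod-sym shift≡s+q)))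
        (row₁≡ j<k (mod-trans j≡s (mod-trans (mod-sym (+q+q s)) (mod-sym (mod-+ʳ (ι q) shift≡s+q)))))
        d≤j ℕ.≤-refl (inj₂ refl)

  UnitAt : List Gen → ℤ → Set
  UnitAt L s = ∃ λ xs → Occurs xs gA L × shift xs ≡ s mod k

  PairAt : List Gen → ℤ → Set
  PairAt L s = ∃ λ xs → Occurs xs gB L × (shift xs ≡ s mod k ⊎ shift xs ≡ s ⊕ ι q mod k)

  PairAt-antipode : ∀ {L s} → PairAt L s → PairAt L (s ⊕ ι q)
  PairAt-antipode (xs , occ , inj₁ shift≡s)   = xs , occ , inj₂ (mod-trans shift≡s (mod-sym (+q+q _)))
  PairAt-antipode (xs , occ , inj₂ shift≡s+q) = xs , occ , inj₁ shift≡s+q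

  data Covered (L : List Gen) (r : ℕ) : Set where
    unit : ∀ {s} → UnitAt L s → ι r ≡ s mod k → Covered L r
    pair : ∀ {s} → PairAt L s → ι r ≡ s mod k → q ≤ r → Covered L r

  covered⇒pivot : ∀ w j → Covered (toList w) (toℕ j) → Pivot w j
  covered⇒pivot w j (unit (xs , occ , shift≡s) j≡s) = unit-pivot w j occ (mod-trans j≡s (mod-sym shift≡s))
  covered⇒pivot w j (pair (xs , occ , shift≡) j≡ q≤j) = pair-pivot w j _ occ shift≡ j≡ q≤j

  solution : ∀ L T (C : ℕ → ℕ) → length L ≡ k → shift L ≡ shift T mod k → sign L ≡ sign T →
    (∀ x → ev T x ≡ C x) → (∀ r → r < k → Covered L r) → Solution q C
  solution L T C len shift≡ sign≡ T≡C covered =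
    w , value , pivots⇒det-unit k (M k q w) (record { σ = σ ; on = on ; below = below })
    where
    w = cast len (fromList L)
    toList-w : toList w ≡ L
    toList-w = trans (Vec.toList-cast len (fromList L)) (Vec.toList∘fromList L)
    value : ∀ i → i < k → V k q w i ≡ C i
    value i i<k = trans (cong (λ ys → ev ys i) toList-w) (trans (eval-cong L T shift≡ sign≡ i i<k) (T≡C i))
    pivot : ∀ j → Pivot w j
    pivot j = covered⇒pivot w j (subst (λ L → Covered L (toℕ j)) (sym toList-w) (covered (toℕ j) (Fin.toℕ<n j)))
    σ = λ j → proj₁ (pivot j)
    on = λ j → proj₁ (proj₂ (pivot j))
    below = λ i → proj₂ (proj₂ (pivot i))

  shape-block-units : ∀ pre a t b post v → v < t + t →
    UnitAt (shape pre a t b post) (shift pre ⊕ sign pre ⊛ ι (a + v))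
  shape-block-units pre a t b post v v<2t with parity v
  ... | i , inj₁ refl =
    pre ++ As a ++ blocks i ++ gB ∷ gB ∷ [] ,
    occurs-++ˡ pre (occurs-++ˡ (As a) (occurs-++ʳ _ (occurs-blocks (gB ∷ gB ∷ []) (half-< {t = t} v<2t) refl))) ,
    shift-pre-++ pre (trans (shift-As-blocks-++ a i _)
      (trans (cong (ι (a + (i + i)) ⊕_) (BB≡0 (ι q))) (ℤ.+-identityʳ _)))
    where BB≡0 : ∀ q → (q ⊕ - 1ℤ) ⊕ - ((q ⊕ - 1ℤ) ⊕ - 0ℤ) ≡ 0ℤ
          BB≡0 = solve-∀
  ... | i , inj₂ refl =
    pre ++ As a ++ blocks i ++ gB ∷ gB ∷ gA ∷ [] ,
    occurs-++ˡ pre (occurs-++ˡ (As a) (occurs-++ʳ _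
      (occurs-blocks (gB ∷ gB ∷ gA ∷ []) (half-< {t = t} (ℕ.<-trans (ℕ.n<1+n _) v<2t)) refl))) ,
    shift-pre-++ pre (trans (shift-As-blocks-++ a i _) (trans (cong (ι (a + (i + i)) ⊕_) (BBA≡1 (ι q)))
      (cong ι (trans (ℕ.+-assoc a (i + i) 1) (cong (a +_) (ℕ.+-comm (i + i) 1))))))
    where BBA≡1 : ∀ q → (q ⊕ - 1ℤ) ⊕ - ((q ⊕ - 1ℤ) ⊕ - (1ℤ ⊕ 0ℤ)) ≡ 1ℤ
          BBA≡1 = solve-∀

  shape-units : ∀ pre a t b post u → u < a + (t + t) + b →
    UnitAt (shape pre a t b post) (shift pre ⊕ sign pre ⊛ ι u)
  shape-units pre a t b post u u<n with split u a
  ... | inj₁ u<a = pre ++ As u , occurs-++ˡ pre (occurs-++ʳ _ (occurs-As u<a)) , shift-pre-++ pre (shift-As u)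
  ... | inj₂ (v , refl) with split v (t + t)
  ...   | inj₁ v<2t = shape-block-units pre a t b post v v<2t
  ...   | inj₂ (x , refl) =
    pre ++ As a ++ blocks t ++ As x ,
    occurs-++ˡ pre (occurs-++ˡ (As a) (occurs-++ˡ (blocks t) (occurs-++ʳ post (occurs-As x<b)))) ,
    shift-pre-++ pre (trans (shift-As-blocks-++ a t (As x))
      (trans (cong (ι (a + (t + t)) ⊕_) (shift-As x)) (cong ι (ℕ.+-assoc a (t + t) x))))
    where
    x<b : x < b
    x<b = ℕ.+-cancelˡ-< (a + (t + t)) x b (subst (_< a + (t + t) + b) (sym (ℕ.+-assoc a (t + t) x)) u<n)

  shape-pairs : ∀ pre a t b post u → u < t + t →
    PairAt (shape pre (suc a) t b post) (shift pre ⊕ sign pre ⊛ ι (a + u))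
  shape-pairs pre a t b post u u<2t with parity u
  ... | i , inj₁ refl =
    pre ++ As (suc a) ++ blocks i ++ gB ∷ [] ,
    occurs-++ˡ pre (occurs-++ˡ (As (suc a)) (occurs-++ʳ _ (occurs-blocks (gB ∷ []) (half-< {t = t} u<2t) refl))) ,
    inj₂ (mod-trans (≡⇒≡-mod shift≡) (mod-+ˡ (shift pre ⊕ sign pre ⊛ ι (a + (i + i))) (sign-q pre)))
    where
    xs = As (suc a) ++ blocks i ++ gB ∷ []
    lemma : ∀ s e a q → s ⊕ e ⊛ ((1ℤ ⊕ a) ⊕ ((q ⊕ - 1ℤ) ⊕ - 0ℤ)) ≡ (s ⊕ e ⊛ a) ⊕ e ⊛ q
    lemma = solve-∀
    shift≡ : shift (pre ++ xs) ≡ (shift pre ⊕ sign pre ⊛ ι (a + (i + i))) ⊕ sign pre ⊛ ι q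
    shift≡ = trans (shift-++ pre xs)
               (trans (cong (λ s → shift pre ⊕ sign pre ⊛ s) (shift-As-blocks-++ (suc a) i (gB ∷ [])))
                 (lemma (shift pre) (sign pre) (ι (a + (i + i))) (ι q)))
  ... | i , inj₂ refl =
    pre ++ As (suc a) ++ blocks i ++ [] ,
    occurs-++ˡ pre (occurs-++ˡ (As (suc a)) (occurs-++ʳ _
      (occurs-blocks [] (half-< {t = t} (ℕ.<-trans (ℕ.n<1+n _) u<2t)) refl))) ,
    inj₁ (shift-pre-++ pre (trans (shift-As-blocks-++ (suc a) i [])
      (trans (ℤ.+-identityʳ _) (cong ι (sym (ℕ.+-suc a (i + i)))))))

  shape-first : ∀ a t b post → PairAt (shape (gB ∷ []) a t b post) 0ℤ
  shape-first a t b post = [] , (_ , refl) , inj₁ mod-refl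

  shape-last : ∀ pre a t b → PairAt (shape pre a t b (gB ∷ [])) (shift pre ⊕ sign pre ⊛ ι (a + (t + t) + b))
  shape-last pre a t b =
    pre ++ As a ++ blocks t ++ As b ,
    occurs-++ˡ pre (occurs-++ˡ (As a) (occurs-++ˡ (blocks t) ([] , refl))) ,
    inj₁ (shift-pre-++ pre (trans (shift-As-blocks-++ a t (As b))
      (cong (ι (a + (t + t)) ⊕_) (shift-As b))))

  shift-shape : ∀ pre a t b post →
    shift (shape pre a t b post) ≡ shift pre ⊕ sign pre ⊛ (ι (a + (t + t) + b) ⊕ shift post)
  shift-shape pre a t b post =
    trans (shift-++ pre _) (cong (λ s → shift pre ⊕ sign pre ⊛ s)
      (trans (shift-As-blocks-++ a t (As b ++ post))
        (trans (cong (ι (a + (t + t)) ⊕_) (shift-As-++ b post))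
          (sym (ℤ.+-assoc (ι (a + (t + t))) (ι b) (shift post))))))

  sign-shape : ∀ pre a t b post → sign (shape pre a t b post) ≡ sign pre ⊛ sign post
  sign-shape pre a t b post =
    trans (sign-++ pre _) (cong (sign pre ⊛_) (trans (sign-As-++ a _) (trans (sign-blocks-++ t _) (sign-As-++ b post))))

  ascending-row : ∀ x → x ≡ shift [] ⊕ sign [] ⊛ x mod k
  ascending-row x = ≡⇒≡-mod (lemma x)
    where lemma : ∀ x → x ≡ 0ℤ ⊕ 1ℤ ⊛ x
          lemma = solve-∀

  descending-row : ∀ {r u} → r + suc u ≡ q → ι r ≡ shift (gB ∷ []) ⊕ sign (gB ∷ []) ⊛ ι u mod k
  descending-row {r} {u} r+1+u≡q =
    ≡⇒≡-mod (trans (isolate {ι r} {1ℤ ⊕ ι u} (cong ι r+1+u≡q)) (lemma (ι q) (ι u)))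
    where lemma : ∀ q u → q ⊕ - (1ℤ ⊕ u) ≡ ((q ⊕ - 1ℤ) ⊕ - 0ℤ) ⊕ - 1ℤ ⊛ u
          lemma = solve-∀

  descending-row-wrap : ∀ {r d} → r + suc d ≡ k →
    ι r ≡ shift (gB ∷ []) ⊕ sign (gB ∷ []) ⊛ ι (q + d) mod k
  descending-row-wrap {r} {d} r+1+d≡k =
    by 1ℤ (trans (isolate {ι r} {1ℤ ⊕ ι d} (cong ι r+1+d≡k)) (lemma (ι q) (ι d)))
    where lemma : ∀ q d →
            (q ⊕ q) ⊕ - (1ℤ ⊕ d) ≡ (((q ⊕ - 1ℤ) ⊕ - 0ℤ) ⊕ - 1ℤ ⊛ (q ⊕ d)) ⊕ 1ℤ ⊛ (q ⊕ q)
          lemma = solve-∀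

  ascending-unit : ∀ a t b post {r} → r < a + (t + t) + b → Covered (shape [] a t b post) r
  ascending-unit a t b post {r} r<n = unit (shape-units [] a t b post r r<n) (ascending-row (ι r))

  ascending-pair : ∀ a t b post {u} → u < t + t → Covered (shape [] (suc a) t b post) (q + (a + u))
  ascending-pair a t b post {u} u<2t =
    pair (PairAt-antipode (shape-pairs [] a t b post u u<2t))
      (mod-trans (≡⇒≡-mod (ℤ.+-comm (ι q) (ι (a + u)))) (mod-+ʳ (ι q) (ascending-row (ι (a + u)))))
      (ℕ.m≤m+n q _)

  ascending-last : ∀ a t b → q ≤ a + (t + t) + b → Covered (shape [] a t b (gB ∷ [])) (a + (t + t) + b)
  ascending-last a t b q≤n = pair (shape-last [] a t b) (ascending-row (ι (a + (t + t) + b))) q≤n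

  descending-low : ∀ a t b post → q ≡ a + (t + t) → ∀ {r} → r < q → Covered (shape (gB ∷ []) a t b post) r
  descending-low a t b post q≡a+2t {r} r<q with gap r<q
  ... | u , r+1+u≡q = unit (shape-units (gB ∷ []) a t b post u u<n) (descending-row r+1+u≡q)
    where
    u<n : u < a + (t + t) + b
    u<n = ℕ.≤-trans (≤-via r (trans (ℕ.+-comm (suc u) r) r+1+u≡q)) (≤-via b (cong (_+ b) q≡a+2t))

  descending-first : ∀ a t b post → Covered (shape (gB ∷ []) a t b post) q
  descending-first a t b post =
    pair (PairAt-antipode (shape-first a t b post)) (≡⇒≡-mod (sym (ℤ.+-identityˡ (ι q)))) ℕ.≤-refl

  descending-pair : ∀ a t b post → q ≡ suc a + (t + t) → ∀ {v} → v < t + t →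
    Covered (shape (gB ∷ []) (suc a) t b post) (q + suc v)
  descending-pair a t b post q≡1+a+2t {v} v<2t with gap v<2t
  ... | d , v+1+d≡2t =
    pair (PairAt-antipode (shape-pairs (gB ∷ []) a t b post d d<2t))
      (≡⇒≡-mod (lemma (ι q) (ι a) (ι (t + t)) (ι v) (ι d) (cong ι v+1+d≡2t) (cong ι q≡1+a+2t)))
      (ℕ.m≤m+n q (suc v))
    where
    d<2t = ≤-via v (trans (ℕ.+-comm (suc d) v) v+1+d≡2t)
    lemma : ∀ q a t v d → v ⊕ (1ℤ ⊕ d) ≡ t → q ≡ (1ℤ ⊕ a) ⊕ t →
      q ⊕ (1ℤ ⊕ v) ≡ (((q ⊕ - 1ℤ) ⊕ - 0ℤ) ⊕ - 1ℤ ⊛ (a ⊕ d)) ⊕ q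
    lemma .((1ℤ ⊕ a) ⊕ (v ⊕ (1ℤ ⊕ d))) a .(v ⊕ (1ℤ ⊕ d)) v d refl refl = solve (a ∷ v ∷ d ∷ [])

  descending-wrap : ∀ a t b post → q ≡ a + (t + t) → ∀ {r} → r < k → k ≤ r + b →
    Covered (shape (gB ∷ []) a t b post) r
  descending-wrap a t b post q≡a+2t {r} r<k k≤r+b with gap r<k
  ... | d , r+1+d≡k = unit (shape-units (gB ∷ []) a t b post (q + d) u<n) (descending-row-wrap r+1+d≡k)
    where
    d<b : d < b
    d<b = ℕ.+-cancelˡ-≤ r (suc d) b (subst (_≤ r + b) (sym r+1+d≡k) k≤r+b)
    u<n : q + d < a + (t + t) + b
    u<n = subst (q + d <_) (cong (_+ b) q≡a+2t) (ℕ.+-monoʳ-< q d<b)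

  descending-last : ∀ a t b → q ≡ a + (t + t) → ∀ {r} → r + suc b ≡ k → q ≤ r →
    Covered (shape (gB ∷ []) a t b (gB ∷ [])) r
  descending-last a t b q≡a+2t {r} r+1+b≡k q≤r =
    pair (shape-last (gB ∷ []) a t b)
      (subst (λ x → ι r ≡ shift (gB ∷ []) ⊕ sign (gB ∷ []) ⊛ ι (x + b) mod k) q≡a+2t
        (descending-row-wrap r+1+b≡k))
      q≤r

-- The four families of words

rotation-large : ∀ t b → Rotation (t + t + b + 1) (t + b)
rotation-large t b = solution L (As n ++ []) _ length≡ shift≡ sign≡ (ev-As-++ n []) covered
  where
  q = t + t + b + 1
  open Words q
  n = suc (suc ((t + b) + (t + b)))
  a = suc (suc b)
  L = shape [] a t b []
  length≡ : length L ≡ k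
  length≡ = trans (length-shape [] a t b []) (lemma t b)
    where lemma : ∀ t b → 0 + ((2 + b) + ((t + t + t + t) + (b + 0))) ≡ (t + t + b + 1) + (t + t + b + 1)
          lemma = ℕ.solve-∀
  shift≡ : shift L ≡ shift (As n ++ []) mod k
  shift≡ = ≡⇒≡-mod (trans (shift-shape [] a t b []) (trans (lemma (ι t) (ι b)) (sym (shift-As-++ n []))))
    where lemma : ∀ t b →
            0ℤ ⊕ 1ℤ ⊛ ((((ι 2 ⊕ b) ⊕ (t ⊕ t)) ⊕ b) ⊕ 0ℤ) ≡ (ι 2 ⊕ ((t ⊕ b) ⊕ (t ⊕ b))) ⊕ 0ℤ
          lemma = solve-∀
  sign≡ : sign L ≡ sign (As n ++ [])
  sign≡ = trans (sign-shape [] a t b []) (sym (sign-As-++ n []))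
  units = a + (t + t) + b
  covered : ∀ r → r < k → Covered L r
  covered r r<k with split r units
  ... | inj₁ r<units   = ascending-unit a t b [] r<units
  ... | inj₂ (u , refl) = subst (Covered L) (lemma t b u) (ascending-pair (suc b) t b [] u<2t)
    where
    lemma : ∀ t b u → (t + t + b + 1) + (suc b + u) ≡ (2 + b + (t + t) + b) + u
    lemma = ℕ.solve-∀
    u<2t : u < t + t
    u<2t = ℕ.+-cancelˡ-< units u (t + t) (subst (units + u <_) (k≡ t b) r<k)
      where k≡ : ∀ t b → (t + t + b + 1) + (t + t + b + 1) ≡ (2 + b + (t + t) + b) + (t + t)
            k≡ = ℕ.solve-∀

reflection-large : ∀ t b → Reflection (t + t + b + 2) (t + b + 1)
reflection-large t b = solution L (As n ++ gB ∷ []) _ length≡ shift≡ sign≡ (ev-As-++ n (gB ∷ [])) covered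
  where
  q = t + t + b + 2
  open Words q
  n = suc ((t + b + 1) + (t + b + 1))
  a = suc (suc (suc b))
  L = shape [] a t b (gB ∷ [])
  length≡ : length L ≡ k
  length≡ = trans (length-shape [] a t b (gB ∷ [])) (lemma t b)
    where lemma : ∀ t b → 0 + ((3 + b) + ((t + t + t + t) + (b + 1))) ≡ (t + t + b + 2) + (t + t + b + 2)
          lemma = ℕ.solve-∀
  shift≡ : shift L ≡ shift (As n ++ gB ∷ []) mod k
  shift≡ = ≡⇒≡-mod (trans (shift-shape [] a t b (gB ∷ []))
             (trans (lemma (ι t) (ι b) (ι q)) (sym (shift-As-++ n (gB ∷ [])))))
    where lemma : ∀ t b q → 0ℤ ⊕ 1ℤ ⊛ ((((ι 3 ⊕ b) ⊕ (t ⊕ t)) ⊕ b) ⊕ ((q ⊕ - 1ℤ) ⊕ - 0ℤ))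
                          ≡ (1ℤ ⊕ (((t ⊕ b) ⊕ 1ℤ) ⊕ ((t ⊕ b) ⊕ 1ℤ))) ⊕ ((q ⊕ - 1ℤ) ⊕ - 0ℤ)
          lemma = solve-∀
  sign≡ : sign L ≡ sign (As n ++ gB ∷ [])
  sign≡ = trans (sign-shape [] a t b (gB ∷ [])) (sym (sign-As-++ n (gB ∷ [])))
  units = a + (t + t) + b
  covered : ∀ r → r < k → Covered L r
  covered r r<k with split r units
  ... | inj₁ r<units       = ascending-unit a t b (gB ∷ []) r<units
  ... | inj₂ (zero , refl) =
    subst (Covered L) (sym (ℕ.+-identityʳ units)) (ascending-last a t b (≤-via (suc b) (lemma t b)))
    where lemma : ∀ t b → (t + t + b + 2) + suc b ≡ 3 + b + (t + t) + b
          lemma = ℕ.solve-∀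
  ... | inj₂ (suc u , refl) = subst (Covered L) (lemma t b u) (ascending-pair (suc (suc b)) t b (gB ∷ []) u<2t)
    where
    lemma : ∀ t b u → (t + t + b + 2) + (suc (suc b) + u) ≡ (3 + b + (t + t) + b) + suc u
    lemma = ℕ.solve-∀
    u<2t : u < t + t
    u<2t = ℕ.s<s⁻¹ (ℕ.+-cancelˡ-< units (suc u) (suc (t + t)) (subst (units + suc u <_) (k≡ t b) r<k))
      where k≡ : ∀ t b → (t + t + b + 2) + (t + t + b + 2) ≡ (3 + b + (t + t) + b) + suc (t + t)
            k≡ = ℕ.solve-∀

reflection-small : ∀ m b → Reflection (m + m + b + 1) m
reflection-small m b = solution L (As n ++ gB ∷ []) _ length≡ shift≡ sign≡ (ev-As-++ n (gB ∷ [])) covered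
  where
  q = m + m + b + 1
  open Words q
  n = suc (m + m)
  L = shape (gB ∷ []) (suc b) m b []
  length≡ : length L ≡ k
  length≡ = trans (length-shape (gB ∷ []) (suc b) m b []) (lemma m b)
    where lemma : ∀ m b → 1 + ((1 + b) + ((m + m + m + m) + (b + 0))) ≡ (m + m + b + 1) + (m + m + b + 1)
          lemma = ℕ.solve-∀
  shift≡ : shift L ≡ shift (As n ++ gB ∷ []) mod k
  shift≡ = mod-trans (≡⇒≡-mod (shift-shape (gB ∷ []) (suc b) m b []))
             (mod-trans (by (- 1ℤ) (lemma (ι m) (ι b))) (≡⇒≡-mod (sym (shift-As-++ n (gB ∷ [])))))
    where lemma : ∀ m b → let q = ((m ⊕ m) ⊕ b) ⊕ 1ℤ in
            ((q ⊕ - 1ℤ) ⊕ - 0ℤ) ⊕ - 1ℤ ⊛ ((((1ℤ ⊕ b) ⊕ (m ⊕ m)) ⊕ b) ⊕ 0ℤ)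
              ≡ ((1ℤ ⊕ (m ⊕ m)) ⊕ ((q ⊕ - 1ℤ) ⊕ - 0ℤ)) ⊕ - 1ℤ ⊛ (q ⊕ q)
          lemma = solve-∀
  sign≡ : sign L ≡ sign (As n ++ gB ∷ [])
  sign≡ = trans (sign-shape (gB ∷ []) (suc b) m b []) (sym (sign-As-++ n (gB ∷ [])))
  q≡1+b+2m : q ≡ suc b + (m + m)
  q≡1+b+2m = lemma m b
    where lemma : ∀ m b → m + m + b + 1 ≡ suc b + (m + m)
          lemma = ℕ.solve-∀
  covered : ∀ r → r < k → Covered L r
  covered r r<k with split r q
  ... | inj₁ r<q           = descending-low (suc b) m b [] q≡1+b+2m r<q
  ... | inj₂ (zero , refl) = subst (Covered L) (sym (ℕ.+-identityʳ q)) (descending-first (suc b) m b [])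
  ... | inj₂ (suc v , refl) with split v (m + m)
  ...   | inj₁ v<2m      = descending-pair b m b [] q≡1+b+2m v<2m
  ...   | inj₂ (w , refl) = descending-wrap (suc b) m b [] q≡1+b+2m r<k (≤-via w (lemma m b w))
    where lemma : ∀ m b w → (m + m + b + 1) + (m + m + b + 1) + w ≡ ((m + m + b + 1) + suc (m + m + w)) + b
          lemma = ℕ.solve-∀

rotation-small : ∀ m b → Rotation (m + m + b + 2) m
rotation-small m b = solution L (As n ++ []) _ length≡ shift≡ sign≡ (ev-As-++ n []) covered
  where
  q = m + m + b + 2
  open Words q
  n = suc (suc (m + m))
  L = shape (gB ∷ []) (suc (suc b)) m b (gB ∷ [])
  length≡ : length L ≡ k
  length≡ = trans (length-shape (gB ∷ []) (suc (suc b)) m b (gB ∷ [])) (lemma m b)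
    where lemma : ∀ m b → 1 + ((2 + b) + ((m + m + m + m) + (b + 1))) ≡ (m + m + b + 2) + (m + m + b + 2)
          lemma = ℕ.solve-∀
  shift≡ : shift L ≡ shift (As n ++ []) mod k
  shift≡ = mod-trans (≡⇒≡-mod (shift-shape (gB ∷ []) (suc (suc b)) m b (gB ∷ [])))
             (mod-trans (by (- 1ℤ) (lemma (ι m) (ι b))) (≡⇒≡-mod (sym (shift-As-++ n []))))
    where lemma : ∀ m b → let q = ((m ⊕ m) ⊕ b) ⊕ ι 2 in
            ((q ⊕ - 1ℤ) ⊕ - 0ℤ) ⊕ - 1ℤ ⊛ ((((ι 2 ⊕ b) ⊕ (m ⊕ m)) ⊕ b) ⊕ ((q ⊕ - 1ℤ) ⊕ - 0ℤ))
              ≡ ((ι 2 ⊕ (m ⊕ m)) ⊕ 0ℤ) ⊕ - 1ℤ ⊛ (q ⊕ q)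
          lemma = solve-∀
  sign≡ : sign L ≡ sign (As n ++ [])
  sign≡ = trans (sign-shape (gB ∷ []) (suc (suc b)) m b (gB ∷ [])) (sym (sign-As-++ n []))
  q≡2+b+2m : q ≡ suc (suc b) + (m + m)
  q≡2+b+2m = lemma m b
    where lemma : ∀ m b → m + m + b + 2 ≡ suc (suc b) + (m + m)
          lemma = ℕ.solve-∀
  covered : ∀ r → r < k → Covered L r
  covered r r<k with split r q
  ... | inj₁ r<q           = descending-low (suc (suc b)) m b (gB ∷ []) q≡2+b+2m r<q
  ... | inj₂ (zero , refl) = subst (Covered L) (sym (ℕ.+-identityʳ q)) (descending-first (suc (suc b)) m b (gB ∷ []))
  ... | inj₂ (suc v , refl) with split v (m + m)
  ...   | inj₁ v<2m = descending-pair (suc b) m b (gB ∷ []) q≡2+b+2m v<2m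
  ...   | inj₂ (zero , refl) =
    descending-last (suc (suc b)) m b q≡2+b+2m (lemma m b) (ℕ.m≤m+n q (suc (m + m + 0)))
    where lemma : ∀ m b → (m + m + b + 2) + suc (m + m + 0) + suc b ≡ (m + m + b + 2) + (m + m + b + 2)
          lemma = ℕ.solve-∀
  ...   | inj₂ (suc w , refl) = descending-wrap (suc (suc b)) m b (gB ∷ []) q≡2+b+2m r<k (≤-via w (lemma m b w))
    where lemma : ∀ m b w → (m + m + b + 2) + (m + m + b + 2) + w ≡ ((m + m + b + 2) + suc (m + m + suc w)) + b
          lemma = ℕ.solve-∀

rotation : ∀ q m → m < q → Rotation q m
rotation q m m<q with suc (m + m) ℕ.<? q
... | yes 2m+1<q with gap 2m+1<q
...   | b , refl = subst (λ q → Rotation q m) (lemma m b) (rotation-small m b)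
  where lemma : ∀ m b → m + m + b + 2 ≡ suc (m + m) + suc b
        lemma = ℕ.solve-∀
rotation q m m<q | no 2m+1≮q with gap m<q
... | t , refl with ≤-gap (ℕ.+-cancelˡ-≤ m t m (ℕ.s≤s⁻¹ (subst (_≤ suc (m + m)) (ℕ.+-suc m t) (ℕ.≮⇒≥ 2m+1≮q))))
...   | b , refl = subst (λ q → Rotation q (t + b)) (lemma t b) (rotation-large t b)
  where lemma : ∀ t b → t + t + b + 1 ≡ (t + b) + suc t
        lemma = ℕ.solve-∀

reflection : ∀ q m → m < q → Reflection q m
reflection q m m<q with m + m ℕ.<? q
... | yes 2m<q with gap 2m<q
...   | b , refl = subst (λ q → Reflection q m) (lemma m b) (reflection-small m b)
  where lemma : ∀ m b → m + m + b + 1 ≡ (m + m) + suc b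
        lemma = ℕ.solve-∀
reflection q m m<q | no 2m≮q with gap m<q
... | t , refl with gap (ℕ.+-cancelˡ-≤ m (suc t) m (ℕ.≮⇒≥ 2m≮q))
...   | b , refl = subst₂ Reflection (lemma t b) (lemma′ t b) (reflection-large t b)
  where lemma : ∀ t b → t + t + b + 2 ≡ (t + suc b) + suc t
        lemma = ℕ.solve-∀
        lemma′ : ∀ t b → t + b + 1 ≡ t + suc b
        lemma′ = ℕ.solve-∀

lemma6 : (q : ℕ) → 2 ≤ q →
    let k = q + q in
    (p : ℕ) → 1 ≤ p → p ≤ k ∸ 1 → p % 2 ≡ 1 →
    (C : ℕ → ℕ) → ((∀ i → i < k → C i ≡ ((A k ^^ p) ∘ B k q) i) ⊎ (∀ i → i < k → C i ≡ (A k ^^ suc p) i)) →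
    ∃ λ (w : Vec Gen k) →
      (∀ i → i < k → V k q w i ≡ C i)
      × (det k (M k q w) ≡ 1ℤ ⊎ det k (M k q w) ≡ - 1ℤ)
lemma6 q _ p _ p≤k-1 p%2≡1 C C≡ with %2≡1⇒odd p p%2≡1
... | m , refl =
  [ (λ C≡AᵖB  → solution-cong C≡AᵖB  (reflection q m m<q))
  , (λ C≡Aᵖ⁺¹ → solution-cong C≡Aᵖ⁺¹ (rotation q m m<q))
  ] C≡
  where m<q = odd-bound q m p≤k-1
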